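{- Let $k \ge 2$. Then $$d_k(P_2 \boxtimes P_n) = \begin{cases} 3, & \text{if } 2 \le n \le 3,\\ 4, & \text{if } 4 \le n \le k+1.\end{cases}$$
   Context: $P_n$ is the path on $n$ vertices. $P_m \boxtimes P_n$ is the strong product (strong grid): vertices $(i,j)$, $0\le i\le m-1$, $0\le j\le n-1$, with distinct $(i,j)$, $(i',j')$ adjacent iff $|i-i'|\le 1$ and $|j-j'|\le 1$. The $k$-move deduction game ($k$ a positive integer) on a finite graph $G$: a layout places a finite number of searchers on vertices of $G$ (several searchers may share a vertex). Every searcher is initially mobile. A vertex is protected once it has been occupied by some searcher (so initially occupied vertices are protected); other vertices are unprotected. The game proceeds in stages. At each stage, for every vertex $v$ that has at least one unprotected neighbour: if the number of mobile searchers on $v$ is at least the number of unprotected neighbours of $v$, then the mobile searchers on $v$ move to the unprotected neighbours of $v$ so that each unprotected neighbour receives at least one searcher; excess mobile searchers on $v$ may also move to any of these unprotected neighbours. All moves in a stage happen simultaneously, newly occupied vertices become protected, and a searcher that has moved $k$ times becomes immobile. The process repeats until all vertices are protected or no searcher can move. A layout is successful if all vertices of $G$ end up protected. The $k$-move deduction number $d_k(G)$ is the minimum number of searchers in a successful layout on $G$. -}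

module Defs where

open import Data.Bool using (Bool; true; false; _∧_; _∨_; not; if_then_else_; T)
open import Data.Nat using (ℕ; zero; suc; _+_; _≤_; _<_; _≤ᵇ_; _<ᵇ_; _≡ᵇ_)
open import Data.Fin using (Fin; toℕ) renaming (zero to fzero; suc to fsuc)
open import Data.Maybe using (Maybe; just; nothing)
open import Data.Product using (Σ; _×_; _,_; proj₁; proj₂; ∃)
open import Relation.Binary.PropositionalEquality using (_≡_)
open import Relation.Nullary using (¬_)

countF : ∀ {m} → (Fin m → Bool) → ℕ
countF {zero}  p = 0
countF {suc m} p = (if p fzero then 1 else 0) + countF (λ i → p (fsuc i))

anyF : ∀ {m} → (Fin m → Bool) → Bool
anyF p = 1 ≤ᵇ countF p

-- The strong grid P_a ⊠ P_b : vertices (i , j), i < a, j < b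

Vtx : ℕ → ℕ → Set
Vtx a b = Fin a × Fin b

eqF : ∀ {m} → Fin m → Fin m → Bool
eqF i j = toℕ i ≡ᵇ toℕ j

eqV : ∀ {a b} → Vtx a b → Vtx a b → Bool
eqV (i , j) (i' , j') = eqF i i' ∧ eqF j j'

near : ℕ → ℕ → Bool
near x y = (x ≤ᵇ suc y) ∧ (y ≤ᵇ suc x)

adj : ∀ {a b} → Vtx a b → Vtx a b → Bool
adj (i , j) (i' , j') =
  near (toℕ i) (toℕ i') ∧ near (toℕ j) (toℕ j') ∧ not (eqV (i , j) (i' , j'))

sumF : ∀ {m} → (Fin m → ℕ) → ℕ
sumF {zero}  f = 0
sumF {suc m} f = f fzero + sumF (λ i → f (fsuc i))

countV : ∀ {a b} → (Vtx a b → Bool) → ℕ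
countV p = sumF (λ i → countF (λ j → p (i , j)))

-- The k-move deduction game on P_a ⊠ P_b with s searchers
-- (searchers are labelled by Fin s; a layout is a map Fin s → vertices).

record State (a b s : ℕ) : Set where
  constructor mkState
  field
    pos  : Fin s → Vtx a b
    used : Fin s → ℕ           -- number of moves made by each searcher
    prot : Vtx a b → Bool
open State public

module _ {a b s : ℕ} (k : ℕ) (st : State a b s) where

  mobile : Fin s → Bool
  mobile i = used st i <ᵇ k

  unprotNbrs : Vtx a b → ℕ
  unprotNbrs v = countV (λ u → adj v u ∧ not (prot st u))

  mobileAt : Vtx a b → ℕ
  mobileAt v = countF (λ i → eqV (pos st i) v ∧ mobile i)

  triggered : Vtx a b → Bool
  triggered v = (1 ≤ᵇ unprotNbrs v) ∧ (unprotNbrs v ≤ᵇ mobileAt v)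

  -- A legal stage: mv i = just u means searcher i moves to u, nothing = stays.
  record LegalStage (mv : Fin s → Maybe (Vtx a b)) : Set where
    field
      valid : ∀ i u → mv i ≡ just u →
                T (mobile i) × T (triggered (pos st i))
                × T (adj (pos st i) u) × T (not (prot st u))
      cover : ∀ v u → T (triggered v) → T (adj v u) → T (not (prot st u)) →
                Σ (Fin s) (λ i → (pos st i ≡ v) × (mv i ≡ just u))

  isJustAt : Maybe (Vtx a b) → Vtx a b → Bool
  isJustAt (just u) w = eqV u w
  isJustAt nothing  w = false

  apply : (Fin s → Maybe (Vtx a b)) → State a b s
  apply mv = mkState
    (λ i → newPos (mv i) (pos st i))
    (λ i → newUsed (mv i) (used st i))
    (λ w → prot st w ∨ anyF (λ i → isJustAt (mv i) w))
    where
      newPos : Maybe (Vtx a b) → Vtx a b → Vtx a b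
      newPos (just u) _ = u
      newPos nothing  p = p
      newUsed : Maybe (Vtx a b) → ℕ → ℕ
      newUsed (just _) n = suc n
      newUsed nothing  n = n

data Succeeds {a b s : ℕ} (k : ℕ) : State a b s → Set where
  done : ∀ {st} → (∀ v → T (prot st v)) → Succeeds k st
  step : ∀ {st} (mv : Fin s → Maybe (Vtx a b)) → LegalStage k st mv →
           Succeeds k (apply k st mv) → Succeeds k st

initState : ∀ {a b s} → (Fin s → Vtx a b) → State a b s
initState {s = s} L = mkState L (λ _ → 0) (λ w → anyF (λ i → eqV (L i) w))

Successful : (a b k s : ℕ) → (Fin s → Vtx a b) → Set
Successful a b k s L = Succeeds k (initState L)

IsDeductionNumber : (a b k d : ℕ) → Set
IsDeductionNumber a b k d =
  Σ (Fin d → Vtx a b) (λ L → Successful a b k d L)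
  × (∀ s → s < d → (L : Fin s → Vtx a b) → ¬ Successful a b k s L)

-- Upper bounds are explicit plays. For n = 2, 3 three searchers finish in one or two
-- stages; for 4 ≤ n ≤ k + 1 two searchers on each vertex of the first column sweep the
-- grid one column per stage, the pair on each vertex splitting over both rows of the
-- next column, so every searcher moves n − 1 ≤ k times.
--
-- Lower bounds. In an initial layout a vertex v can fire only if deg v is at most the
-- number of searchers in its closed neighbourhood: every protected neighbour carries a
-- searcher and every unprotected one needs a mobile searcher on v. All degrees are at
-- least 3, so two searchers never start. With three searchers and n ≥ 4 the firing
-- vertex has degree 3, hence lies in an end column, and all searchers lie in its closed
-- neighbourhood; reversing the columns puts them in columns 0 and 1. From there every
-- play gets stuck with the searchers confined to columns 0–2, as an exhaustive search
-- over all plays on the 2 × 4 window confirms: while searchers stay in columns 0–2 the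
-- window game is the game on P₂ ⊠ Pₙ, and since nobody makes a third move every budget
-- k ≥ 3 acts like k = 3.

module Submission where

open import Defs
open import Data.Nat using (ℕ; _≤_; _+_)
open import Data.Product using (_×_)

open import Data.Bool using (Bool; true; false; _∧_; _∨_; not; if_then_else_; T)
open import Data.Bool.Properties using (∧-identityʳ; ∨-zeroʳ; ∨-identityʳ; ∧-comm; ∧-distribˡ-∨; T-∨; T?)
open import Data.Empty using (⊥; ⊥-elim)
open import Data.Fin using (Fin; toℕ; opposite; inject₁; fromℕ; fromℕ<; splitAt; _↑ˡ_; _↑ʳ_) renaming (zero to fzero; suc to fsuc)
open import Data.Fin.Patterns using (0F; 1F; 2F; 3F)
open import Data.Fin.Properties using (toℕ-injective; toℕ-fromℕ<; toℕ<n; toℕ-↑ˡ; toℕ-↑ʳ; splitAt-↑ˡ; splitAt-↑ʳ; opposite-prop; opposite-involutive; any?)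
open import Data.Maybe using (Maybe; just; nothing) renaming (map to mapMaybe)
open import Data.Nat using (zero; suc; _∸_; _<_; _≤ᵇ_; _<ᵇ_; _≡ᵇ_; z≤n; s≤s; s≤s⁻¹; _<?_)
open import Data.Nat.Properties
open import Algebra.Properties.CommutativeSemigroup +-commutativeSemigroup using (interchange)
open import Data.Product using (Σ; _,_; proj₁; proj₂)
open import Data.Sum using (_⊎_; inj₁; inj₂; [_,_]′)
open import Data.Unit using (tt)
open import Data.Vec using (Vec; []; _∷_; lookup; tabulate)
open import Data.Vec.Properties using (lookup∘tabulate)
open import Function using (_∘_)
open import Function.Bundles using (Equivalence)
open import Relation.Binary.PropositionalEquality
open import Relation.Nullary using (¬_; yes; no; contradiction)

T-∧-intro : ∀ {x y} → T x → T y → T (x ∧ y)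
T-∧-intro {true} _ t = t

T-∧-left : ∀ {x y} → T (x ∧ y) → T x
T-∧-left {true} _ = tt

T-∧-right : ∀ {x y} → T (x ∧ y) → T y
T-∧-right {true} t = t

T-not-elim : ∀ {x} → T (not x) → ¬ T x
T-not-elim {true} () _

T-not-intro : ∀ {x} → ¬ T x → T (not x)
T-not-intro {true} ¬t = ¬t tt
T-not-intro {false} _ = tt

T-⇒-elim : ∀ {x y} → T (not x ∨ y) → T x → T y
T-⇒-elim {true} t _ = t

T-⇒-intro : ∀ {x y} → (T x → T y) → T (not x ∨ y)
T-⇒-intro {true} f = f tt
T-⇒-intro {false} _ = tt

T⇒≡true : ∀ {x} → T x → x ≡ true
T⇒≡true {true} _ = refl

≡true⇒T : ∀ {x} → x ≡ true → T x
≡true⇒T refl = tt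

T-resp-≡ : ∀ {x y} → x ≡ y → T x → T y
T-resp-≡ refl t = t

T-≡-intro : ∀ {x y} → (T x → T y) → (T y → T x) → x ≡ y
T-≡-intro {true} {true} _ _ = refl
T-≡-intro {true} {false} f _ = ⊥-elim (f tt)
T-≡-intro {false} {true} _ g = ⊥-elim (g tt)
T-≡-intro {false} {false} _ _ = refl

b2n : Bool → ℕ
b2n x = if x then 1 else 0

eqF-refl : ∀ {m} (i : Fin m) → T (eqF i i)
eqF-refl i = ≡⇒≡ᵇ (toℕ i) (toℕ i) refl

eqF-sound : ∀ {m} {i j : Fin m} → T (eqF i j) → i ≡ j
eqF-sound {i = i} {j} t = toℕ-injective (≡ᵇ⇒≡ (toℕ i) (toℕ j) t)

eqV-refl : ∀ {a b} (x : Vtx a b) → T (eqV x x)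
eqV-refl (i , j) = T-∧-intro (eqF-refl i) (eqF-refl j)

eqV-sound : ∀ {a b} {x y : Vtx a b} → T (eqV x y) → x ≡ y
eqV-sound {x = i , j} t = cong₂ _,_ (eqF-sound (T-∧-left t)) (eqF-sound (T-∧-right {eqF i _} t))

eqV-complete : ∀ {a b} {x y : Vtx a b} → x ≡ y → T (eqV x y)
eqV-complete {x = x} refl = eqV-refl x

eqV-≡ : ∀ {a b c d} {x y : Vtx a b} {x′ y′ : Vtx c d} →
        (x ≡ y → x′ ≡ y′) → (x′ ≡ y′ → x ≡ y) → eqV x y ≡ eqV x′ y′
eqV-≡ f g = T-≡-intro (λ t → eqV-complete (f (eqV-sound t))) (λ t → eqV-complete (g (eqV-sound t)))

eqV-sym : ∀ {a b} (x y : Vtx a b) → eqV x y ≡ eqV y x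
eqV-sym x y = eqV-≡ {x = x} {y} {y} {x} sym sym

sumF-cong : ∀ {m} {f g : Fin m → ℕ} → (∀ i → f i ≡ g i) → sumF f ≡ sumF g
sumF-cong {zero} e = refl
sumF-cong {suc m} e = cong₂ _+_ (e fzero) (sumF-cong (e ∘ fsuc))

sumF-mono : ∀ {m} {f g : Fin m → ℕ} → (∀ i → f i ≤ g i) → sumF f ≤ sumF g
sumF-mono {zero} _ = z≤n
sumF-mono {suc m} le = +-mono-≤ (le fzero) (sumF-mono (le ∘ fsuc))

sumF-distrib : ∀ {m} (f g : Fin m → ℕ) → sumF (λ i → f i + g i) ≡ sumF f + sumF g
sumF-distrib {zero} f g = refl
sumF-distrib {suc m} f g =
  trans (cong (f fzero + g fzero +_) (sumF-distrib (f ∘ fsuc) (g ∘ fsuc)))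
        (interchange (f fzero) (g fzero) (sumF (f ∘ fsuc)) (sumF (g ∘ fsuc)))

b2n-mono : ∀ {x y} → (T x → T y) → b2n x ≤ b2n y
b2n-mono {false} _ = z≤n
b2n-mono {true} f = ≤-reflexive (cong b2n (sym (T⇒≡true (f tt))))

b2n-∨-≤ : ∀ x y → b2n (x ∨ y) ≤ b2n x + b2n y
b2n-∨-≤ true _ = s≤s z≤n
b2n-∨-≤ false _ = ≤-refl

b2n-∨-disjoint : ∀ {x y} → (T x → ¬ T y) → b2n (x ∨ y) ≡ b2n x + b2n y
b2n-∨-disjoint {true} {true} d = ⊥-elim (d tt tt)
b2n-∨-disjoint {true} {false} _ = refl
b2n-∨-disjoint {false} _ = refl

countF-sumF : ∀ {m} (p : Fin m → Bool) → countF p ≡ sumF (b2n ∘ p)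
countF-sumF {zero} p = refl
countF-sumF {suc m} p = cong (b2n (p fzero) +_) (countF-sumF (p ∘ fsuc))

countF-cong : ∀ {m} {p q : Fin m → Bool} → (∀ i → p i ≡ q i) → countF p ≡ countF q
countF-cong {zero} _ = refl
countF-cong {suc m} e = cong₂ _+_ (cong b2n (e fzero)) (countF-cong (e ∘ fsuc))

countF-false : ∀ {m} (p : Fin m → Bool) → (∀ i → ¬ T (p i)) → countF p ≡ 0
countF-false {zero} p _ = refl
countF-false {suc m} p ¬p with p fzero in eq
... | true = ⊥-elim (¬p fzero (≡true⇒T eq))
... | false = countF-false (p ∘ fsuc) (¬p ∘ fsuc)

countF-≤ : ∀ {m} (p : Fin m → Bool) → countF p ≤ m
countF-≤ {zero} p = z≤n
countF-≤ {suc m} p with p fzero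
... | true = s≤s (countF-≤ (p ∘ fsuc))
... | false = m≤n⇒m≤1+n (countF-≤ (p ∘ fsuc))

countF-mono : ∀ {m} {p q : Fin m → Bool} → (∀ i → T (p i) → T (q i)) → countF p ≤ countF q
countF-mono {zero} _ = z≤n
countF-mono {suc m} p⇒q = +-mono-≤ (b2n-mono (p⇒q fzero)) (countF-mono (p⇒q ∘ fsuc))

countF-∨ : ∀ {m} (p q : Fin m → Bool) → (∀ i → T (p i) → ¬ T (q i)) →
           countF (λ i → p i ∨ q i) ≡ countF p + countF q
countF-∨ p q disjoint = begin
  countF (λ i → p i ∨ q i)               ≡⟨ countF-sumF (λ i → p i ∨ q i) ⟩
  sumF (λ i → b2n (p i ∨ q i))           ≡⟨ sumF-cong (λ i → b2n-∨-disjoint (disjoint i)) ⟩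
  sumF (λ i → b2n (p i) + b2n (q i))     ≡⟨ sumF-distrib (b2n ∘ p) (b2n ∘ q) ⟩
  sumF (b2n ∘ p) + sumF (b2n ∘ q)        ≡⟨ cong₂ _+_ (countF-sumF p) (countF-sumF q) ⟨
  countF p + countF q                    ∎
  where open ≡-Reasoning

countF-witness : ∀ {m} (p : Fin m → Bool) → 1 ≤ countF p → Σ (Fin m) (T ∘ p)
countF-witness {suc m} p h with p fzero in eq
... | true = fzero , ≡true⇒T eq
... | false = let i , t = countF-witness (p ∘ fsuc) h in fsuc i , t

countF-all : ∀ {m} (p : Fin m → Bool) → m ≤ countF p → ∀ i → T (p i)
countF-all {suc m} p h i with p fzero in eq
countF-all {suc m} p h fzero | true = ≡true⇒T eq
countF-all {suc m} p (s≤s h) (fsuc i) | true = countF-all (p ∘ fsuc) h i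
... | false = ⊥-elim (<-irrefl refl (≤-trans h (countF-≤ (p ∘ fsuc))))

anyF-intro : ∀ {m} (p : Fin m → Bool) (i : Fin m) → T (p i) → T (anyF p)
anyF-intro p i t = ≤⇒≤ᵇ (≤-trans (b2n-mono {true} (λ _ → t)) (single i))
  where
    single : ∀ {m} {p : Fin m → Bool} (i : Fin m) → b2n (p i) ≤ countF p
    single fzero = m≤m+n _ _
    single {p = p} (fsuc i) = ≤-trans (single i) (m≤n+m _ (b2n (p fzero)))

anyF-witness : ∀ {m} (p : Fin m → Bool) → T (anyF p) → Σ (Fin m) (T ∘ p)
anyF-witness p t = countF-witness p (≤ᵇ⇒≤ 1 (countF p) t)

anyF-false : ∀ {m} (p : Fin m → Bool) → (∀ i → ¬ T (p i)) → anyF p ≡ false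
anyF-false p ¬p rewrite countF-false p ¬p = refl

countF-eqF : ∀ {m} (i : Fin m) → countF (eqF i) ≡ 1
countF-eqF {suc m} fzero = cong suc (countF-false {m} (λ _ → false) (λ _ ()))
countF-eqF (fsuc i) = countF-eqF i

countF-↑ˡ : ∀ {w m} (p : Fin (w + m) → Bool) → (∀ j → ¬ T (p (w ↑ʳ j))) →
            countF p ≡ countF (λ c → p (c ↑ˡ m))
countF-↑ˡ {zero} p outside = countF-false p outside
countF-↑ˡ {suc w} p outside = cong (b2n (p fzero) +_) (countF-↑ˡ (p ∘ fsuc) outside)

countF-last : ∀ {n} (p : Fin (suc n) → Bool) → countF p ≡ countF (p ∘ inject₁) + b2n (p (fromℕ n))
countF-last {zero} p = +-identityʳ _
countF-last {suc n} p =
  trans (cong (b2n (p fzero) +_) (countF-last (p ∘ fsuc))) (sym (+-assoc (b2n (p fzero)) _ _))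

countF-opposite : ∀ {n} (p : Fin n → Bool) → countF (p ∘ opposite) ≡ countF p
countF-opposite {zero} p = refl
countF-opposite {suc n} p = begin
  b2n (p (fromℕ n)) + countF (p ∘ inject₁ ∘ opposite) ≡⟨ cong (b2n (p (fromℕ n)) +_) (countF-opposite (p ∘ inject₁)) ⟩
  b2n (p (fromℕ n)) + countF (p ∘ inject₁)            ≡⟨ +-comm (b2n (p (fromℕ n))) _ ⟩
  countF (p ∘ inject₁) + b2n (p (fromℕ n))            ≡⟨ countF-last p ⟨
  countF p                                            ∎
  where open ≡-Reasoning

countV-sumF : ∀ {a b} (p : Vtx a b → Bool) → countV p ≡ sumF (λ i → sumF (λ j → b2n (p (i , j))))
countV-sumF p = sumF-cong (λ i → countF-sumF (λ j → p (i , j)))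

countV-cong : ∀ {a b} {p q : Vtx a b → Bool} → (∀ u → p u ≡ q u) → countV p ≡ countV q
countV-cong e = sumF-cong (λ i → countF-cong (λ j → e (i , j)))

countV-mono : ∀ {a b} {p q : Vtx a b → Bool} → (∀ u → T (p u) → T (q u)) → countV p ≤ countV q
countV-mono p⇒q = sumF-mono (λ i → countF-mono (λ j → p⇒q (i , j)))

countV-∨ : ∀ {a b} (p q : Vtx a b → Bool) → (∀ u → T (p u) → ¬ T (q u)) →
           countV (λ u → p u ∨ q u) ≡ countV p + countV q
countV-∨ p q disjoint =
  trans (sumF-cong (λ i → countF-∨ (λ j → p (i , j)) (λ j → q (i , j)) (λ j → disjoint (i , j))))
        (sumF-distrib (λ i → countF (λ j → p (i , j))) (λ i → countF (λ j → q (i , j))))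

countV-∨-≤ : ∀ {a b} (p q : Vtx a b → Bool) → countV (λ u → p u ∨ q u) ≤ countV p + countV q
countV-∨-≤ p q = begin
  countV (λ u → p u ∨ q u)                                          ≡⟨ countV-sumF (λ u → p u ∨ q u) ⟩
  sumF (λ i → sumF (λ j → b2n (p (i , j) ∨ q (i , j))))
    ≤⟨ sumF-mono (λ i → sumF-mono (λ j → b2n-∨-≤ (p (i , j)) (q (i , j)))) ⟩
  sumF (λ i → sumF (λ j → b2n (p (i , j)) + b2n (q (i , j))))
    ≡⟨ sumF-cong (λ i → sumF-distrib (λ j → b2n (p (i , j))) (λ j → b2n (q (i , j)))) ⟩
  sumF (λ i → P i + Q i)                                            ≡⟨ sumF-distrib P Q ⟩
  sumF P + sumF Q                                                   ≡⟨ cong₂ _+_ (countV-sumF p) (countV-sumF q) ⟨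
  countV p + countV q                                               ∎
  where
    open ≤-Reasoning
    P = λ i → sumF (λ j → b2n (p (i , j)))
    Q = λ i → sumF (λ j → b2n (q (i , j)))

countV-eqV : ∀ {a b} (x : Vtx a b) → countV (eqV x) ≡ 1
countV-eqV {b = b} (i , j) = begin
  sumF (λ i′ → countF (λ j′ → eqF i i′ ∧ eqF j j′)) ≡⟨ sumF-cong row ⟩
  sumF (b2n ∘ eqF i)                               ≡⟨ countF-sumF (eqF i) ⟨
  countF (eqF i)                                   ≡⟨ countF-eqF i ⟩
  1                                                ∎
  where
    open ≡-Reasoning
    row : ∀ i′ → countF (λ j′ → eqF i i′ ∧ eqF j j′) ≡ b2n (eqF i i′)
    row i′ with eqF i i′
    ... | true = countF-eqF j
    ... | false = countF-false {b} (λ _ → false) (λ _ ())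

countV-↑ˡ : ∀ {a w m} (p : Vtx a (w + m) → Bool) → (∀ r j → ¬ T (p (r , w ↑ʳ j))) →
            countV p ≡ countV (λ (r , c) → p (r , c ↑ˡ m))
countV-↑ˡ p outside = sumF-cong (λ r → countF-↑ˡ (λ c → p (r , c)) (outside r))

countV-opposite : ∀ {a b} (p : Vtx a b → Bool) → countV (λ (r , c) → p (r , opposite c)) ≡ countV p
countV-opposite p = sumF-cong (λ r → countF-opposite (λ c → p (r , c)))

countV-false : ∀ {a b} (p : Vtx a b → Bool) → (∀ u → ¬ T (p u)) → countV p ≡ 0
countV-false {a} {b} p ¬p = trans (sumF-cong (λ i → countF-false (λ j → p (i , j)) (λ j → ¬p (i , j)))) (zeros a)
  where
    zeros : ∀ a → sumF {a} (λ _ → 0) ≡ 0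
    zeros zero = refl
    zeros (suc a) = zeros a

countV-split : ∀ {a b} (p q : Vtx a b → Bool) → countV p ≡ countV (λ u → p u ∧ q u) + countV (λ u → p u ∧ not (q u))
countV-split p q =
  trans (countV-cong (λ u → split (p u) (q u)))
        (countV-∨ (λ u → p u ∧ q u) (λ u → p u ∧ not (q u)) (λ u t t′ → T-not-elim (T-∧-right {p u} t′) (T-∧-right t)))
  where
    split : ∀ x y → x ≡ (x ∧ y) ∨ (x ∧ not y)
    split true true = refl
    split true false = refl
    split false _ = refl

-- Neighbourhoods and degrees

near-refl : ∀ t → T (near t t)
near-refl t = T-∧-intro (≤⇒≤ᵇ (n≤1+n t)) (≤⇒≤ᵇ (n≤1+n t))

near-suc : ∀ t x → near (suc t) (suc x) ≡ near t x
near-suc zero zero = refl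
near-suc zero (suc x) = refl
near-suc (suc t) zero = refl
near-suc (suc t) (suc x) = refl

near-reflect : ∀ x y x′ y′ → x + x′ ≡ y + y′ → near x y ≡ near x′ y′
near-reflect x y x′ y′ e =
  trans (cong₂ _∧_ (half x y x′ y′ e) (half y x y′ x′ (sym e))) (∧-comm (y′ ≤ᵇ suc x′) _)
  where
    half : ∀ x y x′ y′ → x + x′ ≡ y + y′ → (x ≤ᵇ suc y) ≡ (y′ ≤ᵇ suc x′)
    half x y x′ y′ e = T-≡-intro
      (λ t → ≤⇒≤ᵇ (+-cancelˡ-≤ y y′ (suc x′)
         (subst₂ _≤_ e (sym (+-suc y x′)) (+-monoˡ-≤ x′ (≤ᵇ⇒≤ x (suc y) t)))))
      (λ t → ≤⇒≤ᵇ (+-cancelʳ-≤ x′ x (suc y)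
         (subst₂ _≤_ (sym e) (+-suc y x′) (+-monoʳ-≤ y (≤ᵇ⇒≤ y′ (suc x′) t)))))

near-opposite : ∀ {n} (i j : Fin n) → near (toℕ (opposite i)) (toℕ (opposite j)) ≡ near (toℕ i) (toℕ j)
near-opposite {suc n} i j =
  near-reflect _ _ (toℕ i) (toℕ j) (trans (opposite-+ i) (sym (opposite-+ j)))
  where
    opposite-+ : ∀ (i : Fin (suc n)) → toℕ (opposite i) + toℕ i ≡ n
    opposite-+ i rewrite opposite-prop i = m∸n+n≡m (≤-pred (toℕ<n i))

closedNbr : ∀ {a b} → Vtx a b → Vtx a b → Bool
closedNbr (i , j) (i′ , j′) = near (toℕ i) (toℕ i′) ∧ near (toℕ j) (toℕ j′)

adj-irrefl : ∀ {a b} (v u : Vtx a b) → T (adj v u) → ¬ T (eqV u v)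
adj-irrefl (i , j) (i′ , j′) t e =
  T-not-elim (T-∧-right {near (toℕ j) (toℕ j′)} (T-∧-right {near (toℕ i) (toℕ i′)} t))
             (T-resp-≡ (eqV-sym (i′ , j′) (i , j)) e)

adj-∨-eqV : ∀ {a b} (v u : Vtx a b) → (adj v u ∨ eqV u v) ≡ closedNbr v u
adj-∨-eqV v u with eqV u v in eq
... | true rewrite eqV-sound {x = u} {v} (≡true⇒T eq) =
  trans (∨-zeroʳ (adj v v)) (sym (T⇒≡true (closed-refl v)))
  where
    closed-refl : ∀ {a b} (v : Vtx a b) → T (closedNbr v v)
    closed-refl (i , j) = T-∧-intro (near-refl (toℕ i)) (near-refl (toℕ j))
adj-∨-eqV v@(i , j) u@(i′ , j′) | false rewrite eqV-sym v u | eq =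
  trans (∨-identityʳ _) (cong (near (toℕ i) (toℕ i′) ∧_) (∧-identityʳ _))

degree : ∀ {a b} → Vtx a b → ℕ
degree v = countV (adj v)

degree-closedNbr : ∀ {a b} (v : Vtx a b) → suc (degree v) ≡ countV (closedNbr v)
degree-closedNbr v = begin
  suc (degree v)                          ≡⟨ +-comm 1 (degree v) ⟩
  degree v + 1                            ≡⟨ cong (degree v +_) (trans (countV-cong (λ u → eqV-sym u v)) (countV-eqV v)) ⟨
  degree v + countV (λ u → eqV u v)       ≡⟨ countV-∨ (adj v) (λ u → eqV u v) (adj-irrefl v) ⟨
  countV (λ u → adj v u ∨ eqV u v)        ≡⟨ countV-cong (adj-∨-eqV v) ⟩
  countV (closedNbr v)                    ∎
  where open ≡-Reasoning

nearCount : ℕ → ℕ → ℕ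
nearCount n t = countF {n} (λ j → near t (toℕ j))

nearCount-suc : ∀ n t → nearCount (suc n) (suc t) ≡ b2n (near (suc t) 0) + nearCount n t
nearCount-suc n t = cong (b2n (near (suc t) 0) +_) (countF-cong {n} (λ j → near-suc t (toℕ j)))

nearCount-≤-suc : ∀ n t → nearCount n t ≤ nearCount (suc n) (suc t)
nearCount-≤-suc n t = ≤-trans (m≤n+m _ _) (≤-reflexive (sym (nearCount-suc n t)))

nearCount-self : ∀ {n t} → t < n → 1 ≤ nearCount n t
nearCount-self {suc n} {zero} _ = s≤s z≤n
nearCount-self {suc n} {suc t} (s≤s t<n) = ≤-trans (nearCount-self t<n) (nearCount-≤-suc n t)

nearCount-right : ∀ {n t} → suc t < n → 2 ≤ nearCount n t
nearCount-right {suc (suc n)} {zero} _ = s≤s (s≤s z≤n)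
nearCount-right {suc n} {suc t} (s≤s t<n) = ≤-trans (nearCount-right t<n) (nearCount-≤-suc n t)

nearCount-left : ∀ {n t} → suc t < n → 2 ≤ nearCount n (suc t)
nearCount-left {suc n} {zero} (s≤s t<n) =
  ≤-trans (s≤s (nearCount-self t<n)) (≤-reflexive (sym (nearCount-suc n 0)))
nearCount-left {suc n} {suc t} (s≤s t<n) = ≤-trans (nearCount-left t<n) (nearCount-≤-suc n (suc t))

nearCount-interior : ∀ {n t} → suc (suc t) < n → 3 ≤ nearCount n (suc t)
nearCount-interior {suc n} {zero} (s≤s t<n) =
  ≤-trans (s≤s (nearCount-right t<n)) (≤-reflexive (sym (nearCount-suc n 0)))
nearCount-interior {suc n} {suc t} (s≤s t<n) =
  ≤-trans (nearCount-interior t<n) (nearCount-≤-suc n (suc t))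

nearCount-≥2 : ∀ {n t} → 2 ≤ n → t < n → 2 ≤ nearCount n t
nearCount-≥2 {t = zero} 2≤n _ = nearCount-right 2≤n
nearCount-≥2 {t = suc t} _ t<n = nearCount-left t<n

degree-two-rows : ∀ {n} (v : Vtx 2 n) →
                  suc (degree v) ≡ nearCount n (toℕ (proj₂ v)) + nearCount n (toℕ (proj₂ v))
degree-two-rows {n} v@(r , j) = trans (degree-closedNbr v) (closed r)
  where
    closed : ∀ r → countV (closedNbr (r , j)) ≡ nearCount n (toℕ j) + nearCount n (toℕ j)
    closed fzero = cong (nearCount n (toℕ j) +_) (+-identityʳ _)
    closed (fsuc fzero) = cong (nearCount n (toℕ j) +_) (+-identityʳ _)

degree-≥3 : ∀ {n} (v : Vtx 2 n) → 2 ≤ n → 3 ≤ degree v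
degree-≥3 {n} v@(_ , j) 2≤n = s≤s⁻¹ (begin
  4                                         ≤⟨ +-mono-≤ two two ⟩
  nearCount n (toℕ j) + nearCount n (toℕ j) ≡⟨ degree-two-rows v ⟨
  suc (degree v)                            ∎)
  where
    open ≤-Reasoning
    two = nearCount-≥2 2≤n (toℕ<n j)

degree-≤3⇒end-column : ∀ {n} (v : Vtx 2 n) → degree v ≤ 3 → toℕ (proj₂ v) ≡ 0 ⊎ suc (toℕ (proj₂ v)) ≡ n
degree-≤3⇒end-column {n} v@(_ , j) deg≤3 =
  end (toℕ j) (toℕ<n j) (≤-trans (≤-reflexive (sym (degree-two-rows v))) (s≤s deg≤3))
  where
    end : ∀ t → t < n → nearCount n t + nearCount n t ≤ 4 → t ≡ 0 ⊎ suc t ≡ n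
    end zero _ _ = inj₁ refl
    end (suc t) t<n sum≤4 with suc (suc t) <? n
    ... | no ¬interior = inj₂ (≤-antisym t<n (≮⇒≥ ¬interior))
    ... | yes interior = contradiction (≤-trans (+-mono-≤ three three) sum≤4) (<⇒≱ (s≤s (s≤s (s≤s (s≤s (s≤s z≤n))))))
      where three = nearCount-interior interior

record _≈_ {a b s} (st st′ : State a b s) : Set where
  field
    pos-≡  : ∀ i → pos st i ≡ pos st′ i
    used-≡ : ∀ i → used st i ≡ used st′ i
    prot-≡ : ∀ v → prot st v ≡ prot st′ v
open _≈_

≈-sym : ∀ {a b s} {st st′ : State a b s} → st ≈ st′ → st′ ≈ st
≈-sym e = record { pos-≡ = sym ∘ pos-≡ e ; used-≡ = sym ∘ used-≡ e ; prot-≡ = sym ∘ prot-≡ e }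

module _ {a b s : ℕ} (k : ℕ) where

  triggered-cong : ∀ {st st′ : State a b s} → st ≈ st′ → ∀ v → triggered k st v ≡ triggered k st′ v
  triggered-cong e v = cong₂ (λ x y → (1 ≤ᵇ x) ∧ (x ≤ᵇ y))
    (countV-cong (λ u → cong (λ p → adj v u ∧ not p) (prot-≡ e u)))
    (countF-cong (λ i → cong₂ (λ p n → eqV p v ∧ (n <ᵇ k)) (pos-≡ e i) (used-≡ e i)))

  legal-cong : ∀ {st st′ : State a b s} {mv} → st ≈ st′ → LegalStage k st mv → LegalStage k st′ mv
  legal-cong {st} {st′} {mv} e legal = record { valid = valid′ ; cover = cover′ }
    where
      open LegalStage legal
      valid′ : ∀ i u → mv i ≡ just u → T (mobile k st′ i) × T (triggered k st′ (pos st′ i))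
                                       × T (adj (pos st′ i) u) × T (not (prot st′ u))
      valid′ i u move with valid i u move
      ... | mob , trig , nbr , unprot =
        T-resp-≡ (cong (_<ᵇ k) (used-≡ e i)) mob ,
        T-resp-≡ (trans (triggered-cong e (pos st i)) (cong (triggered k st′) (pos-≡ e i))) trig ,
        T-resp-≡ (cong (λ p → adj p u) (pos-≡ e i)) nbr ,
        T-resp-≡ (cong not (prot-≡ e u)) unprot
      cover′ : ∀ v u → T (triggered k st′ v) → T (adj v u) → T (not (prot st′ u)) →
               Σ (Fin s) (λ i → (pos st′ i ≡ v) × (mv i ≡ just u))
      cover′ v u trig nbr unprot with cover v u (T-resp-≡ (sym (triggered-cong e v)) trig) nbr
                                              (T-resp-≡ (cong not (sym (prot-≡ e u))) unprot)
      ... | i , at , move = i , trans (sym (pos-≡ e i)) at , move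

  apply-cong : ∀ {st st′ : State a b s} mv → st ≈ st′ → apply k st mv ≈ apply k st′ mv
  apply-cong {st} {st′} mv e = record { pos-≡ = pos′ ; used-≡ = used′ ; prot-≡ = prot′ }
    where
      pos′ : ∀ i → pos (apply k st mv) i ≡ pos (apply k st′ mv) i
      pos′ i with mv i
      ... | just _ = refl
      ... | nothing = pos-≡ e i
      used′ : ∀ i → used (apply k st mv) i ≡ used (apply k st′ mv) i
      used′ i with mv i
      ... | just _ = cong suc (used-≡ e i)
      ... | nothing = used-≡ e i
      prot′ : ∀ w → prot (apply k st mv) w ≡ prot (apply k st′ mv) w
      prot′ w = cong (_∨ anyF (λ i → isJustAt k st (mv i) w)) (prot-≡ e w)

  Succeeds-cong : ∀ {st st′ : State a b s} → st ≈ st′ → Succeeds k st → Succeeds k st′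
  Succeeds-cong e (done all) = done (λ v → T-resp-≡ (prot-≡ e v) (all v))
  Succeeds-cong e (step mv legal rest) = step mv (legal-cong e legal) (Succeeds-cong (apply-cong mv e) rest)

  triggered-unprot≤mobile : ∀ {st : State a b s} {v} → T (triggered k st v) → unprotNbrs k st v ≤ mobileAt k st v
  triggered-unprot≤mobile {st} {v} trig = ≤ᵇ⇒≤ _ _ (T-∧-right {1 ≤ᵇ unprotNbrs k st v} trig)

  triggered-occupied : ∀ {st : State a b s} {v} → T (triggered k st v) → Σ (Fin s) (λ i → pos st i ≡ v)
  triggered-occupied {st} {v} trig =
    let i , here = countF-witness (λ i → eqV (pos st i) v ∧ mobile k st i)
                     (≤-trans (≤ᵇ⇒≤ 1 (unprotNbrs k st v) (T-∧-left trig)) (triggered-unprot≤mobile {st} trig))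
    in i , eqV-sound (T-∧-left {eqV (pos st i) v} here)

  idle-stage : ∀ {st : State a b s} {mv} → (∀ v → ¬ T (triggered k st v)) → LegalStage k st mv → apply k st mv ≈ st
  idle-stage {st} {mv} quiet legal = record { pos-≡ = pos′ ; used-≡ = used′ ; prot-≡ = prot′ }
    where
      open LegalStage legal
      stays : ∀ i → mv i ≡ nothing
      stays i with mv i in move
      ... | nothing = refl
      ... | just u = ⊥-elim (quiet (pos st i) (proj₁ (proj₂ (valid i u move))))
      pos′ : ∀ i → pos (apply k st mv) i ≡ pos st i
      pos′ i rewrite stays i = refl
      used′ : ∀ i → used (apply k st mv) i ≡ used st i
      used′ i rewrite stays i = refl
      prot′ : ∀ w → prot (apply k st mv) w ≡ prot st w
      prot′ w = trans (cong (prot st w ∨_) (anyF-false _ (λ i → nobody i))) (∨-identityʳ (prot st w))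
        where
          nobody : ∀ i → ¬ T (isJustAt k st (mv i) w)
          nobody i rewrite stays i = λ ()

  stuck-fails : ∀ {st : State a b s} → (∀ v → ¬ T (triggered k st v)) → ¬ (∀ v → T (prot st v)) → ¬ Succeeds k st
  stuck-fails quiet unfinished (done all) = unfinished all
  stuck-fails quiet unfinished (step mv legal rest) =
    stuck-fails (λ v trig → quiet v (T-resp-≡ (triggered-cong same v) trig))
                (λ all → unfinished (λ v → T-resp-≡ (prot-≡ same v) (all v)))
                rest
    where same = idle-stage quiet legal

Exhaustive : {A : Set} → ((A → Bool) → Bool) → Set
Exhaustive {A} all? = ∀ p → T (all? p) → ∀ x → T (p x)

allF : ∀ {m} → (Fin m → Bool) → Bool
allF {zero} p = true
allF {suc m} p = p fzero ∧ allF (p ∘ fsuc)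

allF-exhaustive : ∀ {m} → Exhaustive (allF {m})
allF-exhaustive p t fzero = T-∧-left t
allF-exhaustive p t (fsuc i) = allF-exhaustive (p ∘ fsuc) (T-∧-right {p fzero} t) i

allF-intro : ∀ {m} (p : Fin m → Bool) → (∀ i → T (p i)) → T (allF p)
allF-intro {zero} p _ = tt
allF-intro {suc m} p all = T-∧-intro (all fzero) (allF-intro (p ∘ fsuc) (all ∘ fsuc))

allV : ∀ {a b} → (Vtx a b → Bool) → Bool
allV p = allF (λ i → allF (λ j → p (i , j)))

allV-exhaustive : ∀ {a b} → Exhaustive (allV {a} {b})
allV-exhaustive p t (i , j) = allF-exhaustive _ (allF-exhaustive _ t i) j

allV-intro : ∀ {a b} (p : Vtx a b → Bool) → (∀ v → T (p v)) → T (allV p)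
allV-intro p all = allF-intro _ (λ i → allF-intro _ (λ j → all (i , j)))

allMaybe : {A : Set} → ((A → Bool) → Bool) → (Maybe A → Bool) → Bool
allMaybe all? p = p nothing ∧ all? (p ∘ just)

allMaybe-exhaustive : {A : Set} {all? : (A → Bool) → Bool} → Exhaustive all? → Exhaustive (allMaybe all?)
allMaybe-exhaustive _ p t nothing = T-∧-left t
allMaybe-exhaustive {all? = all?} ex p t (just x) = ex (p ∘ just) (T-∧-right {p nothing} t) x

allVec : {A : Set} → ((A → Bool) → Bool) → ∀ s → (Fin s → A → Bool) → (Vec A s → Bool) → Bool
allVec all? zero ok P = P []
allVec all? (suc s) ok P = all? (λ x → not (ok fzero x) ∨ allVec all? s (ok ∘ fsuc) (λ xs → P (x ∷ xs)))

allVec-exhaustive : {A : Set} {all? : (A → Bool) → Bool} → Exhaustive all? →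
                    ∀ {s} ok P → T (allVec all? s ok P) → ∀ xs → (∀ i → T (ok i (lookup xs i))) → T (P xs)
allVec-exhaustive ex ok P t [] _ = t
allVec-exhaustive ex ok P t (x ∷ xs) oks =
  allVec-exhaustive ex (ok ∘ fsuc) (λ xs → P (x ∷ xs))
    (T-⇒-elim (ex (λ x → not (ok fzero x) ∨ allVec _ _ (ok ∘ fsuc) (λ xs → P (x ∷ xs))) t x) (oks fzero))
    xs (oks ∘ fsuc)

module _ {a b s : ℕ} (k : ℕ) (st : State a b s) where

  validMoveᵇ : Fin s → Maybe (Vtx a b) → Bool
  validMoveᵇ i nothing = true
  validMoveᵇ i (just u) = adj (pos st i) u ∧ not (prot st u) ∧ mobile k st i ∧ triggered k st (pos st i)

  coveredᵇ : (Fin s → Maybe (Vtx a b)) → Vtx a b → Vtx a b → Bool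
  coveredᵇ mv v u = anyF (λ i → eqV (pos st i) v ∧ isJustAt k st (mv i) u)

  coversᵇ : (Fin s → Maybe (Vtx a b)) → Bool
  coversᵇ mv = allV (λ v → not (triggered k st v) ∨
                      allV (λ u → not (adj v u ∧ not (prot st u)) ∨ coveredᵇ mv v u))

  legalᵇ : (Fin s → Maybe (Vtx a b)) → Bool
  legalᵇ mv = allF (λ i → validMoveᵇ i (mv i)) ∧ coversᵇ mv

  isJustAt-sound : ∀ {o u} → T (isJustAt k st o u) → o ≡ just u
  isJustAt-sound {just x} t = cong just (eqV-sound t)

  legal-fromᵇ : ∀ {mv} → (∀ i → T (validMoveᵇ i (mv i))) → T (coversᵇ mv) → LegalStage k st mv
  legal-fromᵇ {mv} valid covers = record { valid = valid′ ; cover = cover′ }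
    where
      valid′ : ∀ i u → mv i ≡ just u → T (mobile k st i) × T (triggered k st (pos st i))
                                      × T (adj (pos st i) u) × T (not (prot st u))
      valid′ i u move with T-resp-≡ (cong (validMoveᵇ i) move) (valid i)
      ... | t = let nbr , unprot , mob , trig = split t in mob , trig , nbr , unprot
        where
          split : ∀ {w x y z} → T (w ∧ x ∧ y ∧ z) → T w × T x × T y × T z
          split {true} {true} {true} {true} _ = tt , tt , tt , tt
      cover′ : ∀ v u → T (triggered k st v) → T (adj v u) → T (not (prot st u)) →
               Σ (Fin s) (λ i → (pos st i ≡ v) × (mv i ≡ just u))
      cover′ v u trig nbr unprot =
        let at-v = T-⇒-elim (allV-exhaustive _ covers v) trig
            i , t = anyF-witness _ (T-⇒-elim (allV-exhaustive _ at-v u) (T-∧-intro nbr unprot))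
        in i , eqV-sound (T-∧-left t) , isJustAt-sound (T-∧-right {eqV (pos st i) v} t)

  legalᵇ-sound : ∀ mv → T (legalᵇ mv) → LegalStage k st mv
  legalᵇ-sound mv t =
    legal-fromᵇ (allF-exhaustive _ (T-∧-left t)) (T-∧-right {allF (λ i → validMoveᵇ i (mv i))} t)

  legal⇒validMoveᵇ : ∀ {mv} → LegalStage k st mv → ∀ i → T (validMoveᵇ i (mv i))
  legal⇒validMoveᵇ {mv} legal i with mv i in move
  ... | nothing = tt
  ... | just u with LegalStage.valid legal i u move
  ...   | mob , trig , nbr , unprot = T-∧-intro nbr (T-∧-intro unprot (T-∧-intro mob trig))

  legal⇒coversᵇ : ∀ {mv} → LegalStage k st mv → T (coversᵇ mv)
  legal⇒coversᵇ {mv} legal =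
    allV-intro _ (λ v → T-⇒-intro (λ trig →
      allV-intro _ (λ u → T-⇒-intro (λ nbr-unprot →
        let i , at , move = LegalStage.cover legal v u trig (T-∧-left nbr-unprot)
                                             (T-∧-right {adj v u} nbr-unprot)
        in anyF-intro _ i (T-∧-intro (eqV-complete at) (isJustAt-complete move))))))
    where
      isJustAt-complete : ∀ {o u} → o ≡ just u → T (isJustAt k st o u)
      isJustAt-complete {u = u} refl = eqV-refl u

-- Symmetries

module InvolutiveAutomorphism {a b : ℕ} (σ : Vtx a b → Vtx a b)
                              (σ-involutive : ∀ v → σ (σ v) ≡ v)
                              (adj-σ : ∀ u v → adj (σ u) (σ v) ≡ adj u v)
                              (countV-σ : ∀ p → countV (p ∘ σ) ≡ countV p) where

  eqV-σ : ∀ u v → eqV (σ u) (σ v) ≡ eqV u v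
  eqV-σ u v = eqV-≡ {x = σ u} {σ v} {u} {v}
    (λ e → trans (sym (σ-involutive u)) (trans (cong σ e) (σ-involutive v))) (cong σ)

  mapState : ∀ {s} → State a b s → State a b s
  mapState st = mkState (σ ∘ pos st) (used st) (prot st ∘ σ)

  module _ {s : ℕ} (k : ℕ) where

    triggered-σ : ∀ (st : State a b s) v → triggered k (mapState st) (σ v) ≡ triggered k st v
    triggered-σ st v = cong₂ (λ x y → (1 ≤ᵇ x) ∧ (x ≤ᵇ y)) unprot mob
      where
        unprot : unprotNbrs k (mapState st) (σ v) ≡ unprotNbrs k st v
        unprot = trans (sym (countV-σ (λ u → adj (σ v) u ∧ not (prot st (σ u)))))
                       (countV-cong (λ u → cong₂ (λ x y → x ∧ not (prot st y)) (adj-σ v u) (σ-involutive u)))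
        mob : mobileAt k (mapState st) (σ v) ≡ mobileAt k st v
        mob = countF-cong (λ i → cong (_∧ mobile k st i) (eqV-σ (pos st i) v))

    legal-σ : ∀ (st : State a b s) mv → LegalStage k st mv → LegalStage k (mapState st) (mapMaybe σ ∘ mv)
    legal-σ st mv legal = record { valid = valid′ ; cover = cover′ }
      where
        open LegalStage legal
        valid′ : ∀ i u → mapMaybe σ (mv i) ≡ just u →
                 T (mobile k (mapState st) i) × T (triggered k (mapState st) (σ (pos st i)))
                 × T (adj (σ (pos st i)) u) × T (not (prot st (σ u)))
        valid′ i u move with mv i in move′
        valid′ i .(σ x) refl | just x with valid i x move′
        ... | mob , trig , nbr , unprot =
          mob ,
          T-resp-≡ (sym (triggered-σ st (pos st i))) trig ,
          T-resp-≡ (sym (adj-σ (pos st i) x)) nbr ,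
          T-resp-≡ (cong (λ y → not (prot st y)) (sym (σ-involutive x))) unprot
        cover′ : ∀ v u → T (triggered k (mapState st) v) → T (adj v u) → T (not (prot st (σ u))) →
                 Σ (Fin s) (λ i → (σ (pos st i) ≡ v) × (mapMaybe σ (mv i) ≡ just u))
        cover′ v u trig nbr unprot
          with cover (σ v) (σ u)
                     (T-resp-≡ (trans (cong (triggered k (mapState st)) (sym (σ-involutive v))) (triggered-σ st (σ v))) trig)
                     (T-resp-≡ (sym (adj-σ v u)) nbr) unprot
        ... | i , at , move = i , trans (cong σ at) (σ-involutive v) , trans (cong (mapMaybe σ) move) (cong just (σ-involutive u))

    apply-σ : ∀ (st : State a b s) mv → apply k (mapState st) (mapMaybe σ ∘ mv) ≈ mapState (apply k st mv)
    apply-σ st mv = record { pos-≡ = pos′ ; used-≡ = used′ ; prot-≡ = prot′ }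
      where
        pos′ : ∀ i → pos (apply k (mapState st) (mapMaybe σ ∘ mv)) i ≡ pos (mapState (apply k st mv)) i
        pos′ i with mv i
        ... | just _ = refl
        ... | nothing = refl
        used′ : ∀ i → used (apply k (mapState st) (mapMaybe σ ∘ mv)) i ≡ used (mapState (apply k st mv)) i
        used′ i with mv i
        ... | just _ = refl
        ... | nothing = refl
        arrives : ∀ w i → isJustAt k (mapState st) (mapMaybe σ (mv i)) w ≡ isJustAt k st (mv i) (σ w)
        arrives w i with mv i
        ... | just x = trans (cong (eqV (σ x)) (sym (σ-involutive w))) (eqV-σ x (σ w))
        ... | nothing = refl
        prot′ : ∀ w → prot (apply k (mapState st) (mapMaybe σ ∘ mv)) w ≡ prot (mapState (apply k st mv)) w
        prot′ w = cong (λ n → prot st (σ w) ∨ (1 ≤ᵇ n)) (countF-cong (arrives w))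

    Succeeds-σ : ∀ {st : State a b s} → Succeeds k st → Succeeds k (mapState st)
    Succeeds-σ (done all) = done (λ w → all (σ w))
    Succeeds-σ {st} (step mv legal rest) =
      step (mapMaybe σ ∘ mv) (legal-σ st mv legal) (Succeeds-cong k (≈-sym (apply-σ st mv)) (Succeeds-σ rest))

  initState-σ : ∀ {s} (L : Fin s → Vtx a b) → mapState (initState L) ≈ initState (σ ∘ L)
  initState-σ L = record
    { pos-≡ = λ _ → refl
    ; used-≡ = λ _ → refl
    ; prot-≡ = λ w → cong (1 ≤ᵇ_) (countF-cong (λ i →
        trans (sym (eqV-σ (L i) (σ w))) (cong (eqV (σ (L i))) (σ-involutive w))))
    }

flip : ∀ {a n} → Vtx a n → Vtx a n
flip (r , c) = (r , opposite c)

flip-involutive : ∀ {a n} (v : Vtx a n) → flip (flip v) ≡ v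
flip-involutive (r , c) = cong (r ,_) (opposite-involutive c)

adj-flip : ∀ {a n} (u v : Vtx a n) → adj (flip u) (flip v) ≡ adj u v
adj-flip u@(r , i) v@(r′ , j) = cong₂ (λ x y → near (toℕ r) (toℕ r′) ∧ x ∧ not y) (near-opposite i j) eqV-flip
  where
    eqV-flip : eqV (flip u) (flip v) ≡ eqV u v
    eqV-flip = eqV-≡ {x = flip u} {flip v} {u} {v}
      (λ e → trans (sym (flip-involutive u)) (trans (cong flip e) (flip-involutive v))) (cong flip)

module ColumnReversal {a n : ℕ} = InvolutiveAutomorphism {a} {n} flip flip-involutive adj-flip countV-opposite

-- At most two searchers

occupied : ∀ {a b s} → (Fin s → Vtx a b) → Vtx a b → Bool
occupied L u = anyF (λ i → eqV (L i) u)

occupied-suc : ∀ {a b s} (L : Fin (suc s) → Vtx a b) u → occupied L u ≡ (eqV (L fzero) u ∨ occupied (L ∘ fsuc) u)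
occupied-suc L u with eqV (L fzero) u
... | true = refl
... | false = refl

occupied-count : ∀ {a b s} (q : Vtx a b → Bool) (L : Fin s → Vtx a b) →
                 countV (λ u → q u ∧ occupied L u) ≤ countF (q ∘ L)
occupied-count {s = zero} q L = ≤-reflexive (countV-false _ (λ u t → T-∧-right {q u} t))
occupied-count {s = suc s} q L = begin
  countV (λ u → q u ∧ occupied L u)
    ≡⟨ countV-cong (λ u → trans (cong (q u ∧_) (occupied-suc L u)) (∧-distribˡ-∨ (q u) _ _)) ⟩
  countV (λ u → (q u ∧ eqV x u) ∨ (q u ∧ occupied (L ∘ fsuc) u))
    ≤⟨ countV-∨-≤ (λ u → q u ∧ eqV x u) _ ⟩
  countV (λ u → q u ∧ eqV x u) + countV (λ u → q u ∧ occupied (L ∘ fsuc) u)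
    ≤⟨ +-mono-≤ single (occupied-count q (L ∘ fsuc)) ⟩
  b2n (q x) + countF (q ∘ L ∘ fsuc)
    ∎
  where
    open ≤-Reasoning
    x = L fzero
    single : countV (λ u → q u ∧ eqV x u) ≤ b2n (q x)
    single with q x in qx
    ... | true = ≤-trans (countV-mono (λ u t → T-∧-right {q u} t)) (≤-reflexive (countV-eqV x))
    ... | false = ≤-reflexive (countV-false _ (λ u t →
                    subst T qx (subst (T ∘ q) (sym (eqV-sound (T-∧-right {q u} t))) (T-∧-left t))))

degree-≤-nearby : ∀ {a b s} k (L : Fin s → Vtx a b) v → T (triggered k (initState L) v) →
                  degree v ≤ countF (λ i → closedNbr v (L i))
degree-≤-nearby k L v trig = begin
  degree v
    ≡⟨ countV-split (adj v) (occupied L) ⟩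
  countV (λ u → adj v u ∧ occupied L u) + unprotNbrs k (initState L) v
    ≤⟨ +-mono-≤ (occupied-count (adj v) L) (triggered-unprot≤mobile k {initState L} trig) ⟩
  countF (λ i → adj v (L i)) + mobileAt k (initState L) v
    ≤⟨ +-monoʳ-≤ (countF (λ i → adj v (L i))) (countF-mono (λ i → T-∧-left {eqV (L i) v})) ⟩
  countF (λ i → adj v (L i)) + countF (λ i → eqV (L i) v)
    ≡⟨ countF-∨ _ _ (λ i → adj-irrefl v (L i)) ⟨
  countF (λ i → adj v (L i) ∨ eqV (L i) v)
    ≡⟨ countF-cong (λ i → adj-∨-eqV v (L i)) ⟩
  countF (λ i → closedNbr v (L i))
    ∎
  where open ≤-Reasoning

unfinished-initially : ∀ {n s} (L : Fin s → Vtx 2 n) → s < n + n → ¬ (∀ v → T (occupied L v))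
unfinished-initially {n} {s} L s<2n all = <⇒≱ s<2n (begin
  n + n                                 ≡⟨ cong₂ _+_ (countF-true n) (trans (+-identityʳ _) (countF-true n)) ⟨
  countV {2} {n} (λ _ → true)           ≤⟨ countV-mono {p = λ _ → true} {q = λ u → true ∧ occupied L u} (λ u _ → all u) ⟩
  countV (λ u → true ∧ occupied L u)    ≤⟨ occupied-count (λ _ → true) L ⟩
  countF {s} (λ _ → true)               ≡⟨ countF-true s ⟩
  s                                     ∎)
  where
    open ≤-Reasoning
    countF-true : ∀ m → countF {m} (λ _ → true) ≡ m
    countF-true zero = refl
    countF-true (suc m) = cong suc (countF-true m)

few-searchers-fail : ∀ {n s} k → 2 ≤ n → s ≤ 2 → (L : Fin s → Vtx 2 n) → ¬ Succeeds k (initState L)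
few-searchers-fail {n} {s} k 2≤n s≤2 L = stuck-fails k quiet (unfinished-initially L s<2n)
  where
    s<2n : s < n + n
    s<2n = ≤-trans (s≤s s≤2) (+-mono-≤ 2≤n (≤-trans (s≤s z≤n) 2≤n))
    quiet : ∀ v → ¬ T (triggered k (initState L) v)
    quiet v trig = <-irrefl refl (begin-strict
      2                                  <⟨ degree-≥3 v 2≤n ⟩
      degree v                           ≤⟨ degree-≤-nearby k L v trig ⟩
      countF (λ i → closedNbr v (L i))   ≤⟨ countF-≤ _ ⟩
      s                                  ≤⟨ s≤2 ⟩
      2                                  ∎)
      where open ≤-Reasoning

-- Successful layouts

two-columns-succeed : ∀ k → Successful 2 2 (suc k) 3 (λ _ → (0F , 0F))
two-columns-succeed k =
  step moves (legalᵇ-sound (suc k) (initState _) moves tt) (done (allV-exhaustive _ tt))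
  where
    moves : Fin 3 → Maybe (Vtx 2 2)
    moves 0F = just (1F , 0F)
    moves 1F = just (0F , 1F)
    moves 2F = just (1F , 1F)

three-columns-layout : Fin 3 → Vtx 2 3
three-columns-layout 0F = (0F , 0F)
three-columns-layout 1F = (0F , 1F)
three-columns-layout 2F = (1F , 0F)

three-columns-succeed : ∀ k → Successful 2 3 (suc (suc k)) 3 three-columns-layout
three-columns-succeed k =
  step first (legalᵇ-sound K st₀ first tt)
    (step second (legalᵇ-sound K (apply K st₀ first) second tt) (done (allV-exhaustive _ tt)))
  where
    K = suc (suc k)
    st₀ = initState three-columns-layout
    first second : Fin 3 → Maybe (Vtx 2 3)
    first 0F = just (1F , 1F)
    first 1F = nothing
    first 2F = just (1F , 1F)
    second 0F = just (0F , 2F)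
    second 1F = nothing
    second 2F = just (1F , 2F)

-- In the sweep, searcher i stands in row (row p i), where the parity p flips at every
-- stage; the two searchers sharing a vertex are thereby sent to different rows.
row : Bool → Fin 4 → Fin 2
row true 0F = 0F
row true 1F = 0F
row true 2F = 1F
row true 3F = 1F
row false 0F = 0F
row false 1F = 1F
row false 2F = 0F
row false 3F = 1F

row-count : ∀ p r → countF (λ i → eqF (row p i) r) ≡ 2
row-count true 0F = refl
row-count true 1F = refl
row-count false 0F = refl
row-count false 1F = refl

dispatch : ∀ p (r r′ : Fin 2) → Σ (Fin 4) (λ i → row p i ≡ r × row (not p) i ≡ r′)
dispatch true 0F 0F = 0F , refl , refl
dispatch true 0F 1F = 1F , refl , refl
dispatch true 1F 0F = 2F , refl , refl
dispatch true 1F 1F = 3F , refl , refl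
dispatch false 0F 0F = 0F , refl , refl
dispatch false 0F 1F = 2F , refl , refl
dispatch false 1F 0F = 1F , refl , refl
dispatch false 1F 1F = 3F , refl , refl

near-rows : ∀ (r r′ : Fin 2) → near (toℕ r) (toℕ r′) ≡ true
near-rows 0F 0F = refl
near-rows 0F 1F = refl
near-rows 1F 0F = refl
near-rows 1F 1F = refl

module Sweep {n : ℕ} (k : ℕ) where

  sweepState : Bool → (t : ℕ) → t < n → State 2 n 4
  sweepState p t t<n = mkState (λ i → (row p i , fromℕ< t<n)) (λ _ → t) (λ w → toℕ (proj₂ w) ≤ᵇ t)

  advance : Bool → ∀ {t} → suc t < n → Fin 4 → Maybe (Vtx 2 n)
  advance p t+1<n i = just (row (not p) i , fromℕ< t+1<n)

  module _ (p : Bool) {t : ℕ} (t<n : t < n) (t+1<n : suc t < n) (t<k : t < k) where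

    private
      c = fromℕ< t<n
      c′ = fromℕ< t+1<n
      st = sweepState p t t<n

    frontier : ∀ {r u} → T (adj (r , c) u) → T (not (prot st u)) → proj₂ u ≡ c′
    frontier {r} {r′ , j} nbr unprot = toℕ-injective (trans (≤-antisym below above) (sym (toℕ-fromℕ< t+1<n)))
      where
        below : toℕ j ≤ suc t
        below = subst (λ x → toℕ j ≤ suc x) (toℕ-fromℕ< t<n)
                  (≤ᵇ⇒≤ _ _ (T-∧-right {toℕ c ≤ᵇ suc (toℕ j)} (T-∧-left (T-∧-right {near (toℕ r) (toℕ r′)} nbr))))
        above : suc t ≤ toℕ j
        above = ≰⇒> (λ j≤t → T-not-elim unprot (≤⇒≤ᵇ j≤t))

    step-adj : ∀ r r′ → T (adj (r , c) (r′ , c′))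
    step-adj r r′ rewrite near-rows r r′ | toℕ-fromℕ< t<n | toℕ-fromℕ< t+1<n =
      T-∧-intro (T-∧-intro (≤⇒≤ᵇ (m≤n+m t 2)) (≤⇒≤ᵇ (≤-refl {suc t})))
                (T-not-intro (λ eq → 1+n≢n {t} (sym (≡ᵇ⇒≡ t (suc t) (T-∧-right {eqF r r′} eq)))))

    step-unprot : ∀ r′ → T (not (prot st (r′ , c′)))
    step-unprot r′ rewrite toℕ-fromℕ< t+1<n = T-not-intro (λ t+1≤t → 1+n≰n {t} (≤ᵇ⇒≤ (suc t) t t+1≤t))

    sweep-triggered : ∀ r → T (triggered k st (r , c))
    sweep-triggered r = T-∧-intro (≤⇒≤ᵇ some) (≤⇒≤ᵇ (≤-trans at-most-two (≤-reflexive (sym mobile-two))))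
      where
        unprotected : Vtx 2 n → Bool
        unprotected u = adj (r , c) u ∧ not (prot st u)
        at-most-two : countV unprotected ≤ 2
        at-most-two = ≤-trans (countV-mono {p = unprotected} {q = eqF c′ ∘ proj₂} next-column)
                              (≤-reflexive (cong₂ _+_ (countF-eqF c′) (cong (_+ 0) (countF-eqF c′))))
          where
            next-column : ∀ u → T (unprotected u) → T (eqF c′ (proj₂ u))
            next-column u t = subst (T ∘ eqF c′)
              (sym (frontier {r} {u} (T-∧-left {adj (r , c) u} t) (T-∧-right {adj (r , c) u} t))) (eqF-refl c′)
        some : 1 ≤ countV unprotected
        some = ≤-trans (≤-reflexive (sym (countV-eqV (r , c′)))) (countV-mono {p = eqV (r , c′)} {q = unprotected}
                 (λ u at → subst (T ∘ unprotected) (eqV-sound at) (T-∧-intro (step-adj r r) (step-unprot r))))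
        mobile-two : mobileAt k st (r , c) ≡ 2
        mobile-two = trans (countF-cong here) (row-count p r)
          where
            here : ∀ i → (eqF (row p i) r ∧ eqF c c) ∧ (t <ᵇ k) ≡ eqF (row p i) r
            here i rewrite T⇒≡true (eqF-refl c) | T⇒≡true (<⇒<ᵇ t<k) = trans (∧-identityʳ _) (∧-identityʳ _)

    sweep-legal : LegalStage k st (advance p t+1<n)
    sweep-legal = record { valid = valid′ ; cover = cover′ }
      where
        valid′ : ∀ i u → advance p t+1<n i ≡ just u → T (mobile k st i) × T (triggered k st (pos st i))
                                                     × T (adj (pos st i) u) × T (not (prot st u))
        valid′ i _ refl = <⇒<ᵇ t<k , sweep-triggered (row p i) , step-adj (row p i) (row (not p) i) , step-unprot (row (not p) i)
        cover′ : ∀ v u → T (triggered k st v) → T (adj v u) → T (not (prot st u)) →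
                 Σ (Fin 4) (λ i → (pos st i ≡ v) × (advance p t+1<n i ≡ just u))
        cover′ v (r′ , j) trig nbr unprot with triggered-occupied k {st} trig
        ... | _ , refl with dispatch p (proj₁ v) r′
        ...   | i , from , to rewrite frontier {proj₁ v} {r′ , j} nbr unprot =
          i , cong (_, c) from , cong (λ r → just (r , c′)) to

    sweep-apply : apply k st (advance p t+1<n) ≈ sweepState (not p) (suc t) t+1<n
    sweep-apply = record { pos-≡ = λ _ → refl ; used-≡ = λ _ → refl ; prot-≡ = prot′ }
      where
        prot′ : ∀ w → prot (apply k st (advance p t+1<n)) w ≡ (toℕ (proj₂ w) ≤ᵇ suc t)
        prot′ (r , j) = T-≡-intro old-or-new (λ j≤t+1 → old-or-new⁻¹ (m≤n⇒m<n∨m≡n (≤ᵇ⇒≤ (toℕ j) (suc t) j≤t+1)))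
          where
            arriving : Fin 4 → Bool
            arriving i = eqV (row (not p) i , c′) (r , j)
            old-or-new : T ((toℕ j ≤ᵇ t) ∨ anyF arriving) → T (toℕ j ≤ᵇ suc t)
            old-or-new h with toℕ j ≤ᵇ t in old
            ... | true = ≤⇒≤ᵇ (m≤n⇒m≤1+n (≤ᵇ⇒≤ (toℕ j) t (≡true⇒T old)))
            ... | false = let i , arrived = anyF-witness arriving h in
              ≤⇒≤ᵇ (≤-reflexive (trans (cong (toℕ ∘ proj₂) (sym (eqV-sound {x = row (not p) i , c′} arrived)))
                                       (toℕ-fromℕ< t+1<n)))
            old-or-new⁻¹ : toℕ j < suc t ⊎ toℕ j ≡ suc t → T ((toℕ j ≤ᵇ t) ∨ anyF arriving)
            old-or-new⁻¹ (inj₁ j<t+1) = Equivalence.from (T-∨ {toℕ j ≤ᵇ t}) (inj₁ (≤⇒≤ᵇ (≤-pred j<t+1)))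
            old-or-new⁻¹ (inj₂ j≡t+1) =
              let i , _ , to = dispatch p 0F r
              in Equivalence.from (T-∨ {toℕ j ≤ᵇ t}) (inj₂ (anyF-intro arriving i (eqV-complete
                   (cong₂ _,_ to (toℕ-injective (trans (toℕ-fromℕ< t+1<n) (sym j≡t+1)))))))

  sweep-succeeds : ∀ gap p t (t<n : t < n) → suc (t + gap) ≡ n → n ≤ suc k → Succeeds k (sweepState p t t<n)
  sweep-succeeds zero p t t<n t+1≡n _ =
    done (λ (_ , j) → ≤⇒≤ᵇ (≤-pred (≤-trans (toℕ<n j) (≤-reflexive (trans (sym t+1≡n) (cong suc (+-identityʳ t)))))))
  sweep-succeeds (suc gap) p t t<n t+gap+2≡n n≤k+1 =
    step (advance p t+1<n) (sweep-legal p t<n t+1<n t<k)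
      (Succeeds-cong k (≈-sym (sweep-apply p t<n t+1<n t<k))
        (sweep-succeeds gap (not p) (suc t) t+1<n (trans (cong suc (sym (+-suc t gap))) t+gap+2≡n) n≤k+1))
    where
      t+1<n : suc t < n
      t+1<n = ≤-trans (s≤s (s≤s (m≤m+n t gap))) (≤-reflexive (trans (cong suc (sym (+-suc t gap))) t+gap+2≡n))
      t<k : t < k
      t<k = ≤-pred (≤-trans t+1<n n≤k+1)

four-searchers-succeed : ∀ {n} k → suc n ≤ k + 1 → Successful 2 (suc n) k 4 (λ i → (row true i , fzero))
four-searchers-succeed {n} k n+1≤k+1 =
  Succeeds-cong k start (sweep-succeeds n true 0 (s≤s z≤n) refl (subst (suc n ≤_) (+-comm k 1) n+1≤k+1))
  where
    open Sweep {suc n} k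
    start : sweepState true 0 (s≤s z≤n) ≈ initState (λ i → (row true i , fzero))
    start = record { pos-≡ = λ _ → refl ; used-≡ = λ _ → refl ; prot-≡ = column-0 }
      where
        column-0 : ∀ w → (toℕ (proj₂ w) ≤ᵇ 0) ≡ anyF (λ i → eqV (row true i , fzero) w)
        column-0 (0F , fzero) = refl
        column-0 (1F , fzero) = refl
        column-0 (0F , fsuc _) = refl
        column-0 (1F , fsuc _) = refl

-- Restriction to the first columns

data ColumnView (w m : ℕ) : Fin (w + m) → Set where
  inside : (c : Fin w) → ColumnView w m (c ↑ˡ m)
  outside : (j : Fin m) → ColumnView w m (w ↑ʳ j)

columnView : ∀ {w m} (c : Fin (w + m)) → ColumnView w m c
columnView {zero} c = outside c
columnView {suc w} fzero = inside fzero
columnView {suc w} (fsuc c) with columnView {w} c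
... | inside c′ = inside (fsuc c′)
... | outside j = outside j

module Window {a : ℕ} (w m : ℕ) where

  embed : Vtx a w → Vtx a (w + m)
  embed (r , c) = (r , c ↑ˡ m)

  -- An inner vertex has a window column to its right, so its closed neighbourhood lies in
  -- the window.
  Inner : Vtx a w → Set
  Inner (_ , c) = 2 + toℕ c ≤ w

  eqV-embed : ∀ u v → eqV (embed u) (embed v) ≡ eqV u v
  eqV-embed (r , c) (r′ , c′) = cong₂ (λ x y → eqF r r′ ∧ (x ≡ᵇ y)) (toℕ-↑ˡ c m) (toℕ-↑ˡ c′ m)

  adj-embed : ∀ u v → adj (embed u) (embed v) ≡ adj u v
  adj-embed u@(r , c) v@(r′ , c′) =
    cong₂ (λ x e → near (toℕ r) (toℕ r′) ∧ x ∧ not e)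
          (cong₂ near (toℕ-↑ˡ c m) (toℕ-↑ˡ c′ m)) (eqV-embed u v)

  embed-≢-outside : ∀ u r j → ¬ T (eqV (embed u) (r , w ↑ʳ j))
  embed-≢-outside (r₀ , c) r j same =
    <⇒≢ (≤-trans (toℕ<n c) (m≤m+n w (toℕ j)))
        (trans (sym (toℕ-↑ˡ c m))
               (trans (cong (toℕ ∘ proj₂) (eqV-sound {x = r₀ , c ↑ˡ m} {r , w ↑ʳ j} same)) (toℕ-↑ʳ w j)))

  adj-outside : ∀ {u} → Inner u → ∀ r j → ¬ T (adj (embed u) (r , w ↑ʳ j))
  adj-outside {r₀ , c} inner r j nbr = 1+n≰n {suc (toℕ c)} (begin
    2 + toℕ c          ≤⟨ inner ⟩
    w                  ≤⟨ m≤m+n w (toℕ j) ⟩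
    w + toℕ j          ≡⟨ toℕ-↑ʳ w j ⟨
    toℕ (w ↑ʳ j)       ≤⟨ ≤ᵇ⇒≤ _ _ (T-∧-right {toℕ (c ↑ˡ m) ≤ᵇ suc (toℕ (w ↑ʳ j))}
                                      (T-∧-left (T-∧-right {near (toℕ r₀) (toℕ r)} nbr))) ⟩
    suc (toℕ (c ↑ˡ m)) ≡⟨ cong suc (toℕ-↑ˡ c m) ⟩
    suc (toℕ c)        ∎)
    where open ≤-Reasoning

  inWindow : ∀ x → toℕ (proj₂ x) < w → Σ (Vtx a w) (λ v → x ≡ embed v × toℕ (proj₂ v) ≡ toℕ (proj₂ x))
  inWindow (r , c) c<w with columnView {w} {m} c
  ... | inside c′ = (r , c′) , refl , sym (toℕ-↑ˡ c′ m)
  ... | outside j = contradiction (≤-trans (m≤m+n w (toℕ j)) (≤-reflexive (sym (toℕ-↑ʳ w j)))) (<⇒≱ c<w)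

  liftProt : (Vtx a w → Bool) → Vtx a (w + m) → Bool
  liftProt P (r , c) = [ (λ c′ → P (r , c′)) , (λ _ → false) ]′ (splitAt w c)

  liftProt-embed : ∀ P v → liftProt P (embed v) ≡ P v
  liftProt-embed P (r , c) rewrite splitAt-↑ˡ w c m = refl

  liftProt-outside : ∀ P r j → liftProt P (r , w ↑ʳ j) ≡ false
  liftProt-outside P r j rewrite splitAt-↑ʳ w m j = refl

  lift : ∀ {s} → State a w s → State a (w + m) s
  lift A = mkState (embed ∘ pos A) (used A) (liftProt (prot A))

  restrict : Maybe (Vtx a (w + m)) → Maybe (Vtx a w)
  restrict nothing = nothing
  restrict (just (r , c)) = [ (λ c′ → just (r , c′)) , (λ _ → nothing) ]′ (splitAt w c)

  restrict-embed : ∀ v → restrict (just (embed v)) ≡ just v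
  restrict-embed (r , c) rewrite splitAt-↑ˡ w c m = refl

  initState-lift : ∀ {s} (L : Fin s → Vtx a (w + m)) (Lw : Fin s → Vtx a w) →
                   (∀ i → L i ≡ embed (Lw i)) → initState L ≈ lift (initState Lw)
  initState-lift L Lw L≡ = record { pos-≡ = L≡ ; used-≡ = λ _ → refl ; prot-≡ = prot′ }
    where
      prot′ : ∀ x → anyF (λ i → eqV (L i) x) ≡ liftProt (λ v → anyF (λ i → eqV (Lw i) v)) x
      prot′ (r , c) with columnView {w} {m} c
      ... | inside c′ = trans (cong (1 ≤ᵇ_) (countF-cong (λ i → trans (cong (λ y → eqV y (r , c′ ↑ˡ m)) (L≡ i))
                                                                       (eqV-embed (Lw i) (r , c′)))))
                              (sym (liftProt-embed (λ v → anyF (λ i → eqV (Lw i) v)) (r , c′)))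
      ... | outside j = trans (anyF-false _ (λ i same →
                                embed-≢-outside (Lw i) r j (subst (λ y → T (eqV y _)) (L≡ i) same)))
                              (sym (liftProt-outside (λ v → anyF (λ i → eqV (Lw i) v)) r j))

  module _ {s : ℕ} (k K : ℕ) (A : State a w s)
           (inner : ∀ i → Inner (pos A i)) (agree : ∀ i → (used A i <ᵇ k) ≡ (used A i <ᵇ K)) where

    unprotNbrs-lift : ∀ {v} → Inner v → unprotNbrs k (lift A) (embed v) ≡ unprotNbrs K A v
    unprotNbrs-lift {v} inner-v =
      trans (countV-↑ˡ {a} {w} {m} (λ u → adj (embed v) u ∧ not (liftProt (prot A) u))
                       (λ r j t → adj-outside {v} inner-v r j (T-∧-left {adj (embed v) (r , w ↑ʳ j)} t)))
            (countV-cong {p = λ u → adj (embed v) (embed u) ∧ not (liftProt (prot A) (embed u))}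
                         (λ u → cong₂ (λ x p → x ∧ not p) (adj-embed v u) (liftProt-embed (prot A) u)))

    mobileAt-lift : ∀ v → mobileAt k (lift A) (embed v) ≡ mobileAt K A v
    mobileAt-lift v = countF-cong (λ i → cong₂ _∧_ (eqV-embed (pos A i) v) (agree i))

    triggered-lift : ∀ {v} → Inner v → triggered k (lift A) (embed v) ≡ triggered K A v
    triggered-lift {v} inner-v = cong₂ (λ x y → (1 ≤ᵇ x) ∧ (x ≤ᵇ y)) (unprotNbrs-lift {v} inner-v) (mobileAt-lift v)

    triggered-lift⁻¹ : ∀ {x} → T (triggered k (lift A) x) →
                       Σ (Fin s) (λ i → x ≡ embed (pos A i) × T (triggered K A (pos A i)))
    triggered-lift⁻¹ trig with triggered-occupied k {lift A} trig
    ... | i , refl = i , refl , T-resp-≡ (triggered-lift (inner i)) trig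

    quiet-lift : (∀ v → ¬ T (triggered K A v)) → ∀ x → ¬ T (triggered k (lift A) x)
    quiet-lift quiet x trig = let i , _ , trig′ = triggered-lift⁻¹ trig in quiet (pos A i) trig′

    unfinished-lift : ¬ (∀ v → T (prot A v)) → ¬ (∀ x → T (prot (lift A) x))
    unfinished-lift unfinished all = unfinished (λ v → T-resp-≡ (liftProt-embed (prot A) v) (all (embed v)))

    module _ {mv : Fin s → Maybe (Vtx a (w + m))} (legal : LegalStage k (lift A) mv)
             {mvA : Fin s → Maybe (Vtx a w)} (mvA≡ : ∀ i → mvA i ≡ restrict (mv i)) where

      move-view : ∀ i → (mv i ≡ nothing × mvA i ≡ nothing)
                        ⊎ Σ (Vtx a w) (λ u → mv i ≡ just (embed u) × mvA i ≡ just u)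
      move-view i with mv i in move
      ... | nothing = inj₁ (refl , trans (mvA≡ i) (cong restrict move))
      ... | just (r , c) with columnView {w} {m} c
      ...   | inside c′ = inj₂ ((r , c′) , refl , trans (mvA≡ i) (trans (cong restrict move) (restrict-embed (r , c′))))
      ...   | outside j = ⊥-elim (adj-outside {pos A i} (inner i) r j (proj₁ (proj₂ (proj₂ (LegalStage.valid legal i _ move)))))

      legal-restrict : LegalStage K A mvA
      legal-restrict = record { valid = valid′ ; cover = cover′ }
        where
          open LegalStage legal
          valid′ : ∀ i u → mvA i ≡ just u → T (mobile K A i) × T (triggered K A (pos A i))
                                           × T (adj (pos A i) u) × T (not (prot A u))
          valid′ i u moveA with move-view i
          ... | inj₁ (_ , stays) with () ← trans (sym stays) moveA
          ... | inj₂ (u′ , move , moveA′) with trans (sym moveA′) moveA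
          ...   | refl with valid i (embed u′) move
          ...     | mob , trig , nbr , unprot =
            T-resp-≡ (agree i) mob ,
            T-resp-≡ (triggered-lift (inner i)) trig ,
            T-resp-≡ (adj-embed (pos A i) u′) nbr ,
            T-resp-≡ (cong not (liftProt-embed (prot A) u′)) unprot
          cover′ : ∀ v u → T (triggered K A v) → T (adj v u) → T (not (prot A u)) →
                   Σ (Fin s) (λ i → (pos A i ≡ v) × (mvA i ≡ just u))
          cover′ v u trig nbr unprot with triggered-occupied K {A} trig
          ... | i₀ , refl with cover (embed v) (embed u)
                                     (T-resp-≡ (sym (triggered-lift (inner i₀))) trig)
                                     (T-resp-≡ (sym (adj-embed v u)) nbr)
                                     (T-resp-≡ (cong not (sym (liftProt-embed (prot A) u))) unprot)
          ...   | i , at , move =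
            i , eqV-sound (T-resp-≡ (eqV-embed (pos A i) v) (eqV-complete at)) ,
            trans (mvA≡ i) (trans (cong restrict move) (restrict-embed u))

      apply-restrict : apply k (lift A) mv ≈ lift (apply K A mvA)
      apply-restrict = record { pos-≡ = pos′ ; used-≡ = used′ ; prot-≡ = prot′ }
        where
          pos′ : ∀ i → pos (apply k (lift A) mv) i ≡ embed (pos (apply K A mvA) i)
          pos′ i with move-view i
          ... | inj₁ (stays , staysA) rewrite stays | staysA = refl
          ... | inj₂ (u , move , moveA) rewrite move | moveA = refl
          used′ : ∀ i → used (apply k (lift A) mv) i ≡ used (apply K A mvA) i
          used′ i with move-view i
          ... | inj₁ (stays , staysA) rewrite stays | staysA = refl
          ... | inj₂ (u , move , moveA) rewrite move | moveA = refl
          arrives : ∀ v i → isJustAt k (lift A) (mv i) (embed v) ≡ isJustAt K A (mvA i) v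
          arrives v i with move-view i
          ... | inj₁ (stays , staysA) rewrite stays | staysA = refl
          ... | inj₂ (u , move , moveA) rewrite move | moveA = eqV-embed u v
          arrives-outside : ∀ r j i → ¬ T (isJustAt k (lift A) (mv i) (r , w ↑ʳ j))
          arrives-outside r j i with move-view i
          ... | inj₁ (stays , _) rewrite stays = λ ()
          ... | inj₂ (u , move , _) rewrite move = embed-≢-outside u r j
          prot′ : ∀ x → prot (apply k (lift A) mv) x ≡ prot (lift (apply K A mvA)) x
          prot′ (r , c) with columnView {w} {m} c
          ... | inside c′ = trans (cong₂ _∨_ (liftProt-embed (prot A) (r , c′))
                                              (cong (1 ≤ᵇ_) (countF-cong (arrives (r , c′)))))
                                  (sym (liftProt-embed (prot (apply K A mvA)) (r , c′)))
          ... | outside j = trans (cong₂ _∨_ (liftProt-outside (prot A) r j) (anyF-false _ (arrives-outside r j)))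
                                  (sym (liftProt-outside (prot (apply K A mvA)) r j))

module Exhaustion {a s : ℕ} (w K B : ℕ) where

  -- On settled states the window game simulates the full game.
  settledᵇ : State a w s → Bool
  settledᵇ A = allF (λ i → (2 + toℕ (proj₂ (pos A i)) ≤ᵇ w) ∧ (used A i <ᵇ B)) ∧ not (allV (prot A))

  quietᵇ : State a w s → Bool
  quietᵇ A = allV (λ v → not (triggered K A v))

  failsWithin : ℕ → State a w s → Bool
  allStagesFail : ℕ → State a w s → Bool
  failsWithin f A = settledᵇ A ∧ (quietᵇ A ∨ allStagesFail f A)
  allStagesFail zero A = false
  allStagesFail (suc f) A =
    allVec (allMaybe allV) s (validMoveᵇ K A)
      (λ mvs → not (coversᵇ K A (lookup mvs)) ∨ failsWithin f (apply K A (lookup mvs)))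

  module _ (m k : ℕ) (agree : ∀ u → u < B → (u <ᵇ k) ≡ (u <ᵇ K)) where
    open Window {a} w m

    record Settled (A : State a w s) : Set where
      field
        inner      : ∀ i → Inner (pos A i)
        agreeing   : ∀ i → (used A i <ᵇ k) ≡ (used A i <ᵇ K)
        unfinished : ¬ (∀ v → T (prot A v))

    settled-sound : ∀ A → T (settledᵇ A) → Settled A
    settled-sound A settled = record
      { inner = λ i → ≤ᵇ⇒≤ _ _ (T-∧-left (searcher i))
      ; agreeing = λ i → agree (used A i) (<ᵇ⇒< _ _ (T-∧-right {2 + toℕ (proj₂ (pos A i)) ≤ᵇ w} (searcher i)))
      ; unfinished = λ all → T-not-elim (T-∧-right {allF searcherᵇ} settled) (allV-intro _ all)
      }
      where
        searcherᵇ = λ i → (2 + toℕ (proj₂ (pos A i)) ≤ᵇ w) ∧ (used A i <ᵇ B)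
        searcher = allF-exhaustive searcherᵇ (T-∧-left settled)

    failsWithin-sound : ∀ f A → T (failsWithin f A) → ¬ Succeeds k (lift A)
    failsWithin-sound f A fails =
      continue f (settled-sound A (T-∧-left fails)) (Equivalence.to T-∨ (T-∧-right {settledᵇ A} fails))
      where
        continue : ∀ f → Settled A → T (quietᵇ A) ⊎ T (allStagesFail f A) → ¬ Succeeds k (lift A)
        continue f settled (inj₁ quiet) =
          stuck-fails k (quiet-lift k K A inner agreeing (λ v → T-not-elim (allV-exhaustive _ quiet v)))
                        (unfinished-lift k K A inner agreeing unfinished)
          where open Settled settled
        continue (suc f) settled (inj₂ next) (done all) = unfinished-lift k K A inner agreeing unfinished all
          where open Settled settled
        continue (suc f) settled (inj₂ next) (step mv legal rest) =
          failsWithin-sound f (apply K A mvA) fails-next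
            (Succeeds-cong k (apply-restrict k K A inner agreeing legal mvA≡) rest)
          where
            open Settled settled
            mvA = lookup (tabulate (restrict ∘ mv))
            mvA≡ = lookup∘tabulate (restrict ∘ mv)
            legalA = legal-restrict k K A inner agreeing legal mvA≡
            fails-next : T (failsWithin f (apply K A mvA))
            fails-next = T-⇒-elim (allVec-exhaustive (allMaybe-exhaustive allV-exhaustive) (validMoveᵇ K A) _ next
                                                (tabulate (restrict ∘ mv)) (legal⇒validMoveᵇ K A legalA))
                             (legal⇒coversᵇ K A legalA)

-- Three searchers

cornerLayoutsFailᵇ : ℕ → Bool
cornerLayoutsFailᵇ K =
  allVec allV 3 (λ _ v → toℕ (proj₂ v) ≤ᵇ 1)
    (λ L → Exhaustion.failsWithin {2} {3} 4 K 3 3 (initState (lookup L)))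

corner-layouts-checked-2 : cornerLayoutsFailᵇ 2 ≡ true
corner-layouts-checked-2 = refl

corner-layouts-checked-3 : cornerLayoutsFailᵇ 3 ≡ true
corner-layouts-checked-3 = refl

cornerLayoutsFailᵇ-sound : ∀ {K} → cornerLayoutsFailᵇ K ≡ true →
                           ∀ L → (∀ i → T (toℕ (proj₂ (lookup L i)) ≤ᵇ 1)) →
                           T (Exhaustion.failsWithin 4 K 3 3 (initState (lookup L)))
cornerLayoutsFailᵇ-sound {K} checked =
  allVec-exhaustive allV-exhaustive (λ _ v → toℕ (proj₂ v) ≤ᵇ 1)
    (λ L → Exhaustion.failsWithin {2} {3} 4 K 3 3 (initState (lookup L))) (≡true⇒T checked)

corner-layouts-fail-below : ∀ {m} k K → cornerLayoutsFailᵇ K ≡ true → (∀ u → u < 3 → (u <ᵇ k) ≡ (u <ᵇ K)) →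
                            (L : Fin 3 → Vtx 2 (4 + m)) → (∀ i → toℕ (proj₂ (L i)) ≤ 1) → ¬ Succeeds k (initState L)
corner-layouts-fail-below {m} k K checked agree L left run =
  Exhaustion.failsWithin-sound 4 K 3 m k agree 3 (initState (lookup Lw))
    (cornerLayoutsFailᵇ-sound {K} checked Lw (λ i → ≤⇒≤ᵇ (column-≤1 i)))
    (Succeeds-cong k (initState-lift L (lookup Lw) L≡) run)
  where
    open Window {2} 4 m
    window : Fin 3 → Vtx 2 4
    window i = proj₁ (inWindow (L i) (≤-trans (s≤s (left i)) (s≤s (s≤s z≤n))))
    Lw = tabulate window
    L≡ : ∀ i → L i ≡ embed (lookup Lw i)
    L≡ i = trans (proj₁ (proj₂ (inWindow (L i) _))) (cong embed (sym (lookup∘tabulate window i)))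
    column-≤1 : ∀ i → toℕ (proj₂ (lookup Lw i)) ≤ 1
    column-≤1 i = begin
      toℕ (proj₂ (lookup Lw i)) ≡⟨ cong (toℕ ∘ proj₂) (lookup∘tabulate window i) ⟩
      toℕ (proj₂ (window i))    ≡⟨ proj₂ (proj₂ (inWindow (L i) _)) ⟩
      toℕ (proj₂ (L i))         ≤⟨ left i ⟩
      1                         ∎
      where open ≤-Reasoning

corner-layouts-fail : ∀ {m} k → 2 ≤ k → (L : Fin 3 → Vtx 2 (4 + m)) →
                      (∀ i → toℕ (proj₂ (L i)) ≤ 1) → ¬ Succeeds k (initState L)
corner-layouts-fail 1 (s≤s ())
corner-layouts-fail 2 _ = corner-layouts-fail-below 2 2 corner-layouts-checked-2 (λ _ _ → refl)
corner-layouts-fail (suc (suc (suc k))) _ = corner-layouts-fail-below (3 + k) 3 corner-layouts-checked-3 agree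
  where
    -- searchers in settled states have made fewer than 3 moves
    agree : ∀ u → u < 3 → (u <ᵇ 3 + k) ≡ (u <ᵇ 3)
    agree u u<3 = trans (T⇒≡true (<⇒<ᵇ (≤-trans u<3 (m≤m+n 3 k)))) (sym (T⇒≡true (<⇒<ᵇ u<3)))

triggered-corner : ∀ {n} k → 2 ≤ n → (L : Fin 3 → Vtx 2 n) → ∀ v → T (triggered k (initState L) v) →
                   (∀ i → T (closedNbr v (L i))) × (toℕ (proj₂ v) ≡ 0 ⊎ suc (toℕ (proj₂ v)) ≡ n)
triggered-corner k 2≤n L v trig =
  countF-all (λ i → closedNbr v (L i)) (≤-trans (degree-≥3 v 2≤n) nearby) ,
  degree-≤3⇒end-column v (≤-trans nearby (countF-≤ (λ i → closedNbr v (L i))))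
  where nearby = degree-≤-nearby k L v trig

column-near : ∀ {a n} {v x : Vtx a n} → T (closedNbr v x) → T (near (toℕ (proj₂ v)) (toℕ (proj₂ x)))
column-near {v = r , _} {r′ , _} close = T-∧-right {near (toℕ r) (toℕ r′)} close

near-first-column : ∀ {t y} → T (near t y) → t ≡ 0 → y ≤ 1
near-first-column {t} {y} close refl = ≤ᵇ⇒≤ y 1 (T-∧-right {0 ≤ᵇ suc y} close)

near-last-column : ∀ {n} {t} (j : Fin n) → T (near t (toℕ j)) → suc t ≡ n → toℕ (opposite j) ≤ 1
near-last-column {n} {t} j close t+1≡n = begin
  toℕ (opposite j)      ≡⟨ opposite-prop j ⟩
  n ∸ suc (toℕ j)       ≤⟨ m≤n+o⇒m∸n≤o n (suc (toℕ j)) (begin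
    n                      ≡⟨ t+1≡n ⟨
    suc t                  ≤⟨ s≤s (≤ᵇ⇒≤ t (suc (toℕ j)) (T-∧-left close)) ⟩
    suc (suc (toℕ j))      ≡⟨ +-comm 1 (suc (toℕ j)) ⟩
    suc (toℕ j) + 1        ∎) ⟩
  1                     ∎
  where open ≤-Reasoning

three-searchers-fail : ∀ {m} k → 2 ≤ k → (L : Fin 3 → Vtx 2 (4 + m)) → ¬ Succeeds k (initState L)
three-searchers-fail {m} k 2≤k L run
  with any? (λ r → any? (λ c → T? (triggered k (initState L) (r , c))))
... | no quiet = stuck-fails k (λ (r , c) trig → quiet (r , c , trig))
                   (unfinished-initially L (s≤s (s≤s (s≤s (s≤s z≤n))))) run
... | yes (r , c , trig) = at-corner (triggered-corner k (s≤s (s≤s z≤n)) L (r , c) trig)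
  where
    open ColumnReversal
    at-corner : (∀ i → T (closedNbr (r , c) (L i))) × (toℕ c ≡ 0 ⊎ suc (toℕ c) ≡ 4 + m) → ⊥
    at-corner (close , inj₁ c≡0) =
      corner-layouts-fail k 2≤k L (λ i → near-first-column (column-near {v = r , c} (close i)) c≡0) run
    at-corner (close , inj₂ c+1≡n) =
      corner-layouts-fail k 2≤k (flip ∘ L)
        (λ i → near-last-column (proj₂ (L i)) (column-near {v = r , c} (close i)) c+1≡n)
        (Succeeds-cong k (initState-σ L) (Succeeds-σ k run))

theorem5p3 : (k : ℕ) → 2 ≤ k → (n : ℕ) →
    ((2 ≤ n → n ≤ 3 → IsDeductionNumber 2 n k 3)
    × (4 ≤ n → n ≤ k + 1 → IsDeductionNumber 2 n k 4))
theorem5p3 1 (s≤s ())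
theorem5p3 k@(suc (suc k′)) 2≤k n = at-most-three n , from-four n
  where
    fewer-than-three-fail : ∀ {n} → 2 ≤ n → ∀ s → s < 3 → (L : Fin s → Vtx 2 n) → ¬ Successful 2 n k s L
    fewer-than-three-fail 2≤n s s<3 = few-searchers-fail k 2≤n (≤-pred s<3)

    at-most-three : ∀ n → 2 ≤ n → n ≤ 3 → IsDeductionNumber 2 n k 3
    at-most-three 1 (s≤s ()) _
    at-most-three 2 2≤n _ = (_ , two-columns-succeed (suc k′)) , fewer-than-three-fail 2≤n
    at-most-three 3 2≤n _ = (_ , three-columns-succeed k′) , fewer-than-three-fail 2≤n
    at-most-three (suc (suc (suc (suc _)))) _ (s≤s (s≤s (s≤s ())))

    from-four : ∀ n → 4 ≤ n → n ≤ k + 1 → IsDeductionNumber 2 n k 4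
    from-four (suc (suc (suc zero))) (s≤s (s≤s (s≤s ()))) _
    from-four n@(suc (suc (suc (suc m)))) _ n≤k+1 = (_ , four-searchers-succeed k n≤k+1) , fewer-than-four-fail
      where
        fewer-than-four-fail : ∀ s → s < 4 → (L : Fin s → Vtx 2 n) → ¬ Successful 2 n k s L
        fewer-than-four-fail s s<4 with m≤n⇒m<n∨m≡n (≤-pred s<4)
        ... | inj₁ s<3 = fewer-than-three-fail (s≤s (s≤s z≤n)) s s<3
        ... | inj₂ refl = three-searchers-fail k 2≤k
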